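{- Let $\chi(m,r,s)$ be the unique formal power series in $r$ with coefficients in $\mathbb{Z}[m,s]$ satisfying $$f(rs)\chi(m,r,s)=1-rs\,\chi(m,rs,s)\,\chi(m,r,s),\qquad f(x)=1+x(m-1).$$ Then $$\chi(m,r,s)=\sum_{n\ge0}\ \sum_{\mu\in\mathtt{Dyck}(n)}(-r)^{n}m^{\mathrm{Peak}(\mu)}s^{\,n+|Y(\mu_{1}/\mu)|}.$$
   Context: A Dyck path of size $n$ is a lattice path from $(0,0)$ to $(2n,0)$ with steps $U=(1,1)$ and $D=(1,-1)$ that never goes below $y=0$; $\mathtt{Dyck}(n)$ is the set of them (the empty path for $n=0$). For $\mu\in\mathtt{Dyck}(n)$, $\mathrm{Peak}(\mu)$ is the number of occurrences of a step $U$ immediately followed by a step $D$. If $h_0,h_1,\dots,h_{2n}$ are the heights of $\mu$ after $0,1,\dots,2n$ steps, then $|Y(\mu_1/\mu)|=\frac12\left(\sum_{i=0}^{2n}h_i-n\right)$, the number of unit (45°-rotated) boxes lying between the lowest path $\mu_1=(UD)^n$ and $\mu$. -}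

module Defs where

open import Data.Bool using (Bool; true; false; if_then_else_; _∧_)
open import Data.Nat using (ℕ; zero; suc; _+_; _*_; _∸_; _≡ᵇ_; _≤_; _/_)
open import Data.Integer as ℤ using (ℤ; 0ℤ; 1ℤ; -1ℤ)
open import Data.List using (List; []; _∷_; map; foldr; upTo; _++_)
open import Data.Product using (_×_; _,_; ∃)
open import Data.Sum using (_⊎_)
open import Relation.Binary.PropositionalEquality using (_≡_)

-- Formal power series in r, m, s with integer coefficients:
-- F n a b is the coefficient of r^n m^a s^b.

Series : Set
Series = ℕ → ℕ → ℕ → ℤ

-- "coefficients in ℤ[m,s]": for each n, the coefficient of r^n is a
-- polynomial in m, s (finitely many nonzero coefficients).
PolyCoeffs : Series → Set
PolyCoeffs F = ∀ n → ∃ λ B → ∀ a b → (B ≤ a ⊎ B ≤ b) → F n a b ≡ 0ℤ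

_≈_ : Series → Series → Set
F ≈ G = ∀ n a b → F n a b ≡ G n a b

sumℤ : List ℤ → ℤ
sumℤ = foldr ℤ._+_ 0ℤ

antidiag : ℕ → List (ℕ × ℕ)
antidiag n = map (λ i → i , n ∸ i) (upTo (suc n))

mono : ℕ → ℕ → ℕ → Series
mono i j k n a b = if (n ≡ᵇ i) ∧ (a ≡ᵇ j) ∧ (b ≡ᵇ k) then 1ℤ else 0ℤ

_⊕_ : Series → Series → Series
(F ⊕ G) n a b = F n a b ℤ.+ G n a b

_⊖_ : Series → Series → Series
(F ⊖ G) n a b = F n a b ℤ.- G n a b

_⊛_ : Series → Series → Series
(F ⊛ G) n a b =
  sumℤ (map (λ { (i , i') →
    sumℤ (map (λ { (j , j') →
      sumℤ (map (λ { (k , k') → F i j k ℤ.* G i' j' k' }) (antidiag b)) })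
      (antidiag a)) })
    (antidiag n))

infixl 6 _⊕_ _⊖_
infixl 7 _⊛_
infix 4 _≈_

-- substitution r ↦ r s :  χ(m, r, s) ↦ χ(m, r s, s)
substRS : Series → Series
substRS F n a b = if suc b ∸ n ≡ᵇ 0 then 0ℤ else F n a (b ∸ n)

oneS rS sS mS : Series
oneS = mono 0 0 0
rS = mono 1 0 0
sS = mono 0 0 1
mS = mono 0 1 0

f-rs : Series
f-rs = oneS ⊕ (rS ⊛ sS) ⊛ (mS ⊖ oneS)

FunEq : Series → Set
FunEq χ = f-rs ⊛ χ ≈ (oneS ⊖ rS ⊛ sS ⊛ substRS χ ⊛ χ)

data Step : Set where
  U D : Step

words : ℕ → List (List Step)
words zero = [] ∷ []
words (suc k) = map (U ∷_) (words k) ++ map (D ∷_) (words k)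

validFrom : ℕ → List Step → Bool
validFrom zero [] = true
validFrom (suc h) [] = false
validFrom h (U ∷ w) = validFrom (suc h) w
validFrom zero (D ∷ w) = false
validFrom (suc h) (D ∷ w) = validFrom h w

isDyck : List Step → Bool
isDyck = validFrom 0

filterB : {A : Set} → (A → Bool) → List A → List A
filterB p [] = []
filterB p (x ∷ xs) = if p x then x ∷ filterB p xs else filterB p xs

Dyck : ℕ → List (List Step)
Dyck n = filterB isDyck (words (2 * n))

Peak : List Step → ℕ
Peak [] = 0
Peak (U ∷ D ∷ w) = suc (Peak (D ∷ w))
Peak (_ ∷ w) = Peak w

heightSumFrom : ℕ → List Step → ℕ
heightSumFrom h [] = h
heightSumFrom h (U ∷ w) = h + heightSumFrom (suc h) w
heightSumFrom h (D ∷ w) = h + heightSumFrom (h ∸ 1) w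

-- |Y(μ₁/μ)| = (Σ_{i=0}^{2n} h_i - n) / 2   for μ ∈ Dyck(n)
areaY : ℕ → List Step → ℕ
areaY n μ = (heightSumFrom 0 μ ∸ n) / 2

sign : ℕ → ℤ
sign zero = 1ℤ
sign (suc n) = ℤ.- sign n

dyckSeries : Series
dyckSeries n a b =
  sumℤ (map (λ μ → if (a ≡ᵇ Peak μ) ∧ (b ≡ᵇ n + areaY n μ) then sign n else 0ℤ)
            (Dyck n))

-- Comparing coefficients of rⁿ, the functional equation expresses χₙ through χ₀, …, χₙ₋₁, because
-- r s χ(m, r s, s) has no constant term; this gives uniqueness. For existence, cut a nonempty Dyck path
-- at its first return to the axis, μ = U u D v. Then Peak μ = Peak u + Peak v + [u = ε] and the area
-- gains |u|/2 boxes, which is exactly the shift s^(size u) of χ(m, r s, s). Hence the terms with u ≠ ε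
-- cancel against r s χ(m, r s, s) χ(m, r, s), and those with u = ε produce r s (m − 1) χ(m, r, s).
module Submission where

open import Defs
open import Data.Bool using (Bool; true; false; if_then_else_; _∧_)
open import Data.List using (List; []; _∷_; map; _++_; length; applyUpTo)
open import Data.List.Properties using (map-∘; map-applyUpTo)
open import Data.List.Membership.Propositional using (_∈_)
open import Data.List.Membership.Propositional.Properties using (∈-map⁻; ∈-++⁻)
open import Data.List.Relation.Unary.Any using (here; there)
open import Data.Nat as ℕ using (ℕ; zero; suc; _∸_; _≡ᵇ_; _≤ᵇ_; _≤_; _<_; s≤s; z≤n)
import Data.Nat.Properties as ℕP
open import Data.Nat.DivMod using (_/_; m*n/n≡m; m/n≤m)
open import Data.Nat.Induction using (<-rec)
open import Data.Integer using (ℤ; 0ℤ; 1ℤ)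
import Data.Integer.Properties as ℤP
open import Data.Product using (_×_; _,_; proj₁; proj₂; ∃)
open import Data.Sum using (_⊎_; inj₁; inj₂)
open import Function using (_∘_)
open import Relation.Binary.PropositionalEquality

-- Dyck path statistics

module _ where
  open import Data.Nat using (_+_; _*_)
  open import Data.Nat.Tactic.RingSolver using (solve-∀)
  open ≡-Reasoning

  validFrom-U : ∀ h w → validFrom h (U ∷ w) ≡ validFrom (suc h) w
  validFrom-U zero    w = refl
  validFrom-U (suc h) w = refl

  ∈-filterB : ∀ {A : Set} (p : A → Bool) (L : List A) {x} → x ∈ filterB p L → p x ≡ true × x ∈ L
  ∈-filterB p (y ∷ L) x∈ with p y in py
  ∈-filterB p (y ∷ L) (here refl) | true  = py , here refl
  ∈-filterB p (y ∷ L) (there x∈)  | true  = let px , x∈L = ∈-filterB p L x∈ in px , there x∈L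
  ∈-filterB p (y ∷ L) x∈          | false = let px , x∈L = ∈-filterB p L x∈ in px , there x∈L

  ∈-words⇒length : ∀ k {w} → w ∈ words k → length w ≡ k
  ∈-words⇒length zero (here refl) = refl
  ∈-words⇒length (suc k) w∈ with ∈-++⁻ (map (U ∷_) (words k)) w∈
  ... | inj₁ w∈U with ∈-map⁻ (U ∷_) w∈U
  ...   | w′ , w′∈ , refl = cong suc (∈-words⇒length k w′∈)
  ∈-words⇒length (suc k) w∈ | inj₂ w∈D with ∈-map⁻ (D ∷_) w∈D
  ...   | w′ , w′∈ , refl = cong suc (∈-words⇒length k w′∈)

  ∈-Dyck : ∀ n {μ} → μ ∈ Dyck n → isDyck μ ≡ true × length μ ≡ 2 * n
  ∈-Dyck n μ∈ = let valid , μ∈words = ∈-filterB isDyck (words (2 * n)) μ∈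
                in valid , ∈-words⇒length (2 * n) μ∈words

  -- A path valid from height h ends with D, so appending D ∷ v creates no peak at the junction.
  Peak-++-D : ∀ h u v → validFrom h u ≡ true → Peak (u ++ D ∷ v) ≡ Peak u + Peak v
  Peak-++-D h       []          v valid = refl
  Peak-++-D (suc h) (D ∷ u)     v valid = Peak-++-D h u v valid
  Peak-++-D h       (U ∷ [])    v valid with () ← trans (sym (validFrom-U h [])) valid
  Peak-++-D h       (U ∷ U ∷ u) v valid =
    Peak-++-D (suc h) (U ∷ u) v (trans (sym (validFrom-U h (U ∷ u))) valid)
  Peak-++-D h       (U ∷ D ∷ u) v valid =
    cong suc (Peak-++-D (suc h) (D ∷ u) v (trans (sym (validFrom-U h (D ∷ u))) valid))

  nilIndicator : List Step → ℕ
  nilIndicator []      = 1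
  nilIndicator (_ ∷ _) = 0

  Peak-firstReturn : ∀ u v → isDyck u ≡ true → Peak (U ∷ u ++ D ∷ v) ≡ nilIndicator u + (Peak u + Peak v)
  Peak-firstReturn []      v valid = refl
  Peak-firstReturn (U ∷ u) v valid = Peak-++-D 0 (U ∷ u) v valid

  -- xs returns from h to 0, so starting it c higher adds c at each of its steps and ys starts at c.
  heightSumFrom-++ : ∀ h c xs ys → validFrom h xs ≡ true →
    heightSumFrom (h + c) (xs ++ ys) ≡ heightSumFrom h xs + length xs * c + heightSumFrom c ys
  heightSumFrom-++ zero c [] ys valid = refl
  heightSumFrom-++ h c (U ∷ xs) ys valid = begin
      h + c + heightSumFrom (suc h + c) (xs ++ ys)
    ≡⟨ cong (h + c +_) (heightSumFrom-++ (suc h) c xs ys (trans (sym (validFrom-U h xs)) valid)) ⟩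
      h + c + (heightSumFrom (suc h) xs + length xs * c + heightSumFrom c ys)
    ≡⟨ regroup h c (heightSumFrom (suc h) xs) (length xs * c) (heightSumFrom c ys) ⟩
      h + heightSumFrom (suc h) xs + (c + length xs * c) + heightSumFrom c ys
    ∎
    where
    regroup : ∀ h c s l r → h + c + (s + l + r) ≡ h + s + (c + l) + r
    regroup = solve-∀
  heightSumFrom-++ (suc h) c (D ∷ xs) ys valid = begin
      suc h + c + heightSumFrom (h + c) (xs ++ ys)
    ≡⟨ cong (suc h + c +_) (heightSumFrom-++ h c xs ys valid) ⟩
      suc h + c + (heightSumFrom h xs + length xs * c + heightSumFrom c ys)
    ≡⟨ regroup (suc h) c (heightSumFrom h xs) (length xs * c) (heightSumFrom c ys) ⟩
      suc h + heightSumFrom h xs + (c + length xs * c) + heightSumFrom c ys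
    ∎
    where
    regroup : ∀ h c s l r → h + c + (s + l + r) ≡ h + s + (c + l) + r
    regroup = solve-∀

  parity half : ℕ → ℕ
  parity zero          = 0
  parity (suc zero)    = 1
  parity (suc (suc n)) = parity n
  half zero          = 0
  half (suc zero)    = 0
  half (suc (suc n)) = suc (half n)

  parity+2*half : ∀ n → parity n + 2 * half n ≡ n
  parity+2*half zero          = refl
  parity+2*half (suc zero)    = refl
  parity+2*half (suc (suc n)) = begin
      parity n + 2 * suc (half n)        ≡⟨ shift (parity n) (half n) ⟩
      suc (suc (parity n + 2 * half n))  ≡⟨ cong (suc ∘ suc) (parity+2*half n) ⟩
      suc (suc n)                        ∎
    where
    shift : ∀ p q → p + 2 * suc q ≡ suc (suc (p + 2 * q))
    shift = solve-∀

  -- The height sum of the path of length L oscillating between heights 0 and 1, starting at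
  -- height parity h; for h = 0 and L = 2n it is the lowest Dyck path (UD)ⁿ.
  zigzagSum : ℕ → ℕ → ℕ
  zigzagSum h zero    = parity h
  zigzagSum h (suc L) = parity h + zigzagSum (suc h) L

  zigzagSum-+2 : ∀ h L → zigzagSum (suc (suc h)) L ≡ zigzagSum h L
  zigzagSum-+2 h zero    = refl
  zigzagSum-+2 h (suc L) = cong (parity h +_) (zigzagSum-+2 (suc h) L)

  zigzagSum-lowest : ∀ n → zigzagSum 0 (2 * n) ≡ n
  zigzagSum-lowest zero    = refl
  zigzagSum-lowest (suc n) = begin
      zigzagSum 0 (2 * suc n)         ≡⟨ cong (zigzagSum 0) (ℕP.*-suc 2 n) ⟩
      suc (zigzagSum 2 (2 * n))       ≡⟨ cong suc (zigzagSum-+2 0 (2 * n)) ⟩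
      suc (zigzagSum 0 (2 * n))       ≡⟨ cong suc (zigzagSum-lowest n) ⟩
      suc n                           ∎

  split-parity : ∀ h z k → h + (z + 2 * k) ≡ parity h + z + 2 * (half h + k)
  split-parity h z k = begin
      h + (z + 2 * k)                          ≡⟨ cong (_+ (z + 2 * k)) (sym (parity+2*half h)) ⟩
      parity h + 2 * half h + (z + 2 * k)      ≡⟨ regroup (parity h) (half h) z k ⟩
      parity h + z + 2 * (half h + k)          ∎
    where
    regroup : ∀ p q z k → p + 2 * q + (z + 2 * k) ≡ p + z + 2 * (q + k)
    regroup = solve-∀

  -- Every height of a valid path has the parity of the corresponding zigzag height.
  heightSum≡zigzagSum+even : ∀ h u → validFrom h u ≡ true →
    ∃ λ k → heightSumFrom h u ≡ zigzagSum h (length u) + 2 * k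
  heightSum≡zigzagSum+even zero [] valid = 0 , refl
  heightSum≡zigzagSum+even h (U ∷ u) valid
    with k , eq ← heightSum≡zigzagSum+even (suc h) u (trans (sym (validFrom-U h u)) valid)
    = half h + k , trans (cong (h +_) eq) (split-parity h (zigzagSum (suc h) (length u)) k)
  heightSum≡zigzagSum+even (suc h) (D ∷ u) valid
    with k , eq ← heightSum≡zigzagSum+even h u valid
    = half (suc h) + k
    , trans (cong (suc h +_) (trans eq (cong (_+ 2 * k) (sym (zigzagSum-+2 h (length u))))))
            (split-parity (suc h) (zigzagSum (suc (suc h)) (length u)) k)

  areaY-from-heightSum : ∀ n w A → heightSumFrom 0 w ≡ n + 2 * A → areaY n w ≡ A
  areaY-from-heightSum n w A hs = begin
      (heightSumFrom 0 w ∸ n) / 2   ≡⟨ cong (λ t → (t ∸ n) / 2) hs ⟩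
      (n + 2 * A ∸ n) / 2           ≡⟨ cong (_/ 2) (ℕP.m+n∸m≡n n (2 * A)) ⟩
      2 * A / 2                     ≡⟨ cong (_/ 2) (ℕP.*-comm 2 A) ⟩
      A * 2 / 2                     ≡⟨ m*n/n≡m A 2 ⟩
      A                             ∎

  heightSum-Dyck : ∀ n {μ} → μ ∈ Dyck n → heightSumFrom 0 μ ≡ n + 2 * areaY n μ
  heightSum-Dyck n {μ} μ∈ with k , eq ← heightSum≡zigzagSum+even 0 μ (proj₁ (∈-Dyck n μ∈)) =
    trans hs (cong (λ A → n + 2 * A) (sym (areaY-from-heightSum n μ k hs)))
    where
    hs : heightSumFrom 0 μ ≡ n + 2 * k
    hs = begin
      heightSumFrom 0 μ                    ≡⟨ eq ⟩
      zigzagSum 0 (length μ) + 2 * k       ≡⟨ cong (λ L → zigzagSum 0 L + 2 * k) (proj₂ (∈-Dyck n μ∈)) ⟩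
      zigzagSum 0 (2 * n) + 2 * k          ≡⟨ cong (_+ 2 * k) (zigzagSum-lowest n) ⟩
      n + 2 * k                            ∎

  sDegree : ℕ → List Step → ℕ
  sDegree n μ = n + areaY n μ

  sDegree-firstReturn : ∀ {i j u v} → u ∈ Dyck i → v ∈ Dyck j →
    sDegree (suc (i + j)) (U ∷ u ++ D ∷ v) ≡ suc (i + sDegree i u) + sDegree j v
  sDegree-firstReturn {i} {j} {u} {v} u∈ v∈ = begin
      suc (i + j) + areaY (suc (i + j)) (U ∷ u ++ D ∷ v)
    ≡⟨ cong (suc (i + j) +_) (areaY-from-heightSum (suc (i + j)) (U ∷ u ++ D ∷ v) (A + B + i) heightSum-w) ⟩
      suc (i + j) + (A + B + i)
    ≡⟨ regroup i j A B ⟩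
      suc (i + (i + A)) + (j + B)
    ∎
    where
    A = areaY i u
    B = areaY j v
    regroup : ∀ i j A B → suc (i + j) + (A + B + i) ≡ suc (i + (i + A)) + (j + B)
    regroup = solve-∀
    expand : ∀ i j A B → i + 2 * A + 2 * i * 1 + suc (j + 2 * B) ≡ suc (i + j) + 2 * (A + B + i)
    expand = solve-∀
    heightSum-w : heightSumFrom 0 (U ∷ u ++ D ∷ v) ≡ suc (i + j) + 2 * (A + B + i)
    heightSum-w = begin
        heightSumFrom 1 (u ++ D ∷ v)
      ≡⟨ heightSumFrom-++ 0 1 u (D ∷ v) (proj₁ (∈-Dyck i u∈)) ⟩
        heightSumFrom 0 u + length u * 1 + suc (heightSumFrom 0 v)
      ≡⟨ cong₂ (λ x L → x + L * 1 + suc (heightSumFrom 0 v)) (heightSum-Dyck i u∈) (proj₂ (∈-Dyck i u∈)) ⟩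
        i + 2 * A + 2 * i * 1 + suc (heightSumFrom 0 v)
      ≡⟨ cong (λ y → i + 2 * A + 2 * i * 1 + suc y) (heightSum-Dyck j v∈) ⟩
        i + 2 * A + 2 * i * 1 + suc (j + 2 * B)
      ≡⟨ expand i j A B ⟩
        suc (i + j) + 2 * (A + B + i)
      ∎

module _ where
  open import Data.Nat using (_+_; _*_)
  open import Data.Nat.Tactic.RingSolver using (solve-∀)
  open ℕP.≤-Reasoning

  Peak≤length : ∀ w → Peak w ≤ length w
  Peak≤length []          = z≤n
  Peak≤length (U ∷ [])    = z≤n
  Peak≤length (U ∷ U ∷ w) = ℕP.m≤n⇒m≤1+n (Peak≤length (U ∷ w))
  Peak≤length (U ∷ D ∷ w) = s≤s (Peak≤length (D ∷ w))
  Peak≤length (D ∷ w)     = ℕP.m≤n⇒m≤1+n (Peak≤length w)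

  heightSumFrom≤ : ∀ h w → heightSumFrom h w ≤ suc (length w) * (h + length w)
  heightSumFrom≤ h [] = ℕP.≤-reflexive (identity h)
    where
    identity : ∀ h → h ≡ 1 * (h + 0)
    identity = solve-∀
  heightSumFrom≤ h (U ∷ w) = let L = length w in begin
      h + heightSumFrom (suc h) w           ≤⟨ ℕP.+-monoʳ-≤ h (heightSumFrom≤ (suc h) w) ⟩
      h + suc L * (suc h + L)               ≤⟨ ℕP.m≤m+n _ (suc L) ⟩
      h + suc L * (suc h + L) + suc L       ≡⟨ expand h L ⟩
      suc (suc L) * (h + suc L)             ∎
    where
    expand : ∀ h L → h + suc L * (suc h + L) + suc L ≡ suc (suc L) * (h + suc L)
    expand = solve-∀
  heightSumFrom≤ h (D ∷ w) = let L = length w in begin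
      h + heightSumFrom (h ∸ 1) w                  ≤⟨ ℕP.+-monoʳ-≤ h (heightSumFrom≤ (h ∸ 1) w) ⟩
      h + suc L * (h ∸ 1 + L)                      ≤⟨ ℕP.+-monoʳ-≤ h (ℕP.*-monoʳ-≤ (suc L)
                                                          (ℕP.+-monoˡ-≤ L (ℕP.m∸n≤m h 1))) ⟩
      h + suc L * (h + L)                          ≤⟨ ℕP.m≤m+n _ (suc L + suc L) ⟩
      h + suc L * (h + L) + (suc L + suc L)        ≡⟨ expand h L ⟩
      suc (suc L) * (h + suc L)                    ∎
    where
    expand : ∀ h L → h + suc L * (h + L) + (suc L + suc L) ≡ suc (suc L) * (h + suc L)
    expand = solve-∀

  areaY≤heightSum : ∀ n w → areaY n w ≤ heightSumFrom 0 w
  areaY≤heightSum n w = begin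
    (heightSumFrom 0 w ∸ n) / 2    ≤⟨ m/n≤m _ 2 ⟩
    heightSumFrom 0 w ∸ n          ≤⟨ ℕP.m∸n≤m _ n ⟩
    heightSumFrom 0 w              ∎

  degreeBound : ℕ → ℕ
  degreeBound n = suc (2 * n + (n + suc (2 * n) * (2 * n)))

  Peak<degreeBound : ∀ n {μ} → μ ∈ Dyck n → Peak μ < degreeBound n
  Peak<degreeBound n {μ} μ∈ = s≤s (begin
    Peak μ                                   ≤⟨ Peak≤length μ ⟩
    length μ                                 ≡⟨ proj₂ (∈-Dyck n μ∈) ⟩
    2 * n                                    ≤⟨ ℕP.m≤m+n _ _ ⟩
    2 * n + (n + suc (2 * n) * (2 * n))      ∎)

  sDegree<degreeBound : ∀ n {μ} → μ ∈ Dyck n → sDegree n μ < degreeBound n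
  sDegree<degreeBound n {μ} μ∈ = s≤s (begin
    n + areaY n μ                                 ≤⟨ ℕP.+-monoʳ-≤ n (areaY≤heightSum n μ) ⟩
    n + heightSumFrom 0 μ                         ≤⟨ ℕP.+-monoʳ-≤ n heightSum≤ ⟩
    n + suc (2 * n) * (2 * n)                     ≤⟨ ℕP.m≤n+m _ (2 * n) ⟩
    2 * n + (n + suc (2 * n) * (2 * n))           ∎)
    where
    heightSum≤ : heightSumFrom 0 μ ≤ suc (2 * n) * (2 * n)
    heightSum≤ = subst (λ L → heightSumFrom 0 μ ≤ suc L * L) (proj₂ (∈-Dyck n μ∈)) (heightSumFrom≤ 0 μ)

open import Data.Integer using (_+_; _*_; -_; _-_)
open import Data.Integer.Tactic.RingSolver using (solve-∀)
open ≡-Reasoning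

when : Bool → ℤ → ℤ
when b x = if b then x else 0ℤ

when-∧ : ∀ x y c → (if x ∧ y then c else 0ℤ) ≡ when x (when y c)
when-∧ true  y c = refl
when-∧ false y c = refl

when-comm : ∀ x y c → when x (when y c) ≡ when y (when x c)
when-comm true  true  c = refl
when-comm true  false c = refl
when-comm false true  c = refl
when-comm false false c = refl

when-0 : ∀ x → when x 0ℤ ≡ 0ℤ
when-0 true  = refl
when-0 false = refl

when-neg : ∀ x c → when x (- c) ≡ - when x c
when-neg true  c = refl
when-neg false c = refl

∑-list : {A : Set} → List A → (A → ℤ) → ℤ
∑-list L f = sumℤ (map f L)

infixr 8 ∑-list
syntax ∑-list L (λ x → e) = ∑[ x ← L ] e

module _ {A : Set} where

  ∑-++ : ∀ (L M : List A) f → ∑-list (L ++ M) f ≡ ∑-list L f + ∑-list M f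
  ∑-++ []      M f = sym (ℤP.+-identityˡ _)
  ∑-++ (x ∷ L) M f = trans (cong (f x +_) (∑-++ L M f)) (sym (ℤP.+-assoc (f x) _ _))

  ∑-map : ∀ {B : Set} (L : List A) (g : A → B) f → ∑-list (map g L) f ≡ ∑-list L (f ∘ g)
  ∑-map []      g f = refl
  ∑-map (x ∷ L) g f = cong (f (g x) +_) (∑-map L g f)

  ∑-cong-∈ : ∀ (L : List A) {f g} → (∀ x → x ∈ L → f x ≡ g x) → ∑-list L f ≡ ∑-list L g
  ∑-cong-∈ []      eq = refl
  ∑-cong-∈ (x ∷ L) eq = cong₂ _+_ (eq x (here refl)) (∑-cong-∈ L (λ y y∈ → eq y (there y∈)))

  ∑-cong : ∀ (L : List A) {f g} → (∀ x → f x ≡ g x) → ∑-list L f ≡ ∑-list L g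
  ∑-cong L eq = ∑-cong-∈ L (λ x _ → eq x)

  ∑-0 : ∀ (L : List A) → ∑[ x ← L ] 0ℤ ≡ 0ℤ
  ∑-0 []      = refl
  ∑-0 (x ∷ L) = trans (ℤP.+-identityˡ _) (∑-0 L)

  ∑-vanishes : ∀ (L : List A) {f} → (∀ x → x ∈ L → f x ≡ 0ℤ) → ∑-list L f ≡ 0ℤ
  ∑-vanishes L eq = trans (∑-cong-∈ L eq) (∑-0 L)

  ∑-+ : ∀ (L : List A) f g → ∑[ x ← L ] (f x + g x) ≡ ∑-list L f + ∑-list L g
  ∑-+ []      f g = refl
  ∑-+ (x ∷ L) f g = trans (cong (f x + g x +_) (∑-+ L f g)) (interchange (f x) (g x) _ _)
    where
    interchange : ∀ a b c d → a + b + (c + d) ≡ a + c + (b + d)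
    interchange = solve-∀

  ∑-neg : ∀ (L : List A) f → ∑[ x ← L ] (- f x) ≡ - ∑-list L f
  ∑-neg []      f = refl
  ∑-neg (x ∷ L) f = trans (cong (- f x +_) (∑-neg L f)) (sym (ℤP.neg-distrib-+ (f x) _))

  ∑-*ˡ : ∀ (L : List A) c f → ∑[ x ← L ] (c * f x) ≡ c * ∑-list L f
  ∑-*ˡ []      c f = sym (ℤP.*-zeroʳ c)
  ∑-*ˡ (x ∷ L) c f = trans (cong (c * f x +_) (∑-*ˡ L c f)) (sym (ℤP.*-distribˡ-+ c (f x) _))

  ∑-*ʳ : ∀ (L : List A) c f → ∑[ x ← L ] (f x * c) ≡ ∑-list L f * c
  ∑-*ʳ []      c f = sym (ℤP.*-zeroˡ c)
  ∑-*ʳ (x ∷ L) c f = trans (cong (f x * c +_) (∑-*ʳ L c f)) (sym (ℤP.*-distribʳ-+ c (f x) _))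

  ∑-when : ∀ (L : List A) b f → ∑[ x ← L ] when b (f x) ≡ when b (∑-list L f)
  ∑-when L true  f = refl
  ∑-when L false f = ∑-0 L

  ∑-filterB : ∀ p (L : List A) f → ∑-list (filterB p L) f ≡ ∑[ x ← L ] when (p x) (f x)
  ∑-filterB p []      f = refl
  ∑-filterB p (x ∷ L) f with p x
  ... | true  = cong (f x +_) (∑-filterB p L f)
  ... | false = trans (∑-filterB p L f) (sym (ℤP.+-identityˡ _))

∑-*-∑ : ∀ {A B : Set} (L : List A) (M : List B) f g →
  ∑-list L f * ∑-list M g ≡ ∑[ x ← L ] ∑[ y ← M ] (f x * g y)
∑-*-∑ L M f g = trans (sym (∑-*ʳ L (∑-list M g) f)) (∑-cong L (λ x → sym (∑-*ˡ M (f x) g)))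

∑-antidiag : ℕ → (ℕ → ℕ → ℤ) → ℤ
∑-antidiag zero    F = F 0 0
∑-antidiag (suc n) F = F 0 (suc n) + ∑-antidiag n (λ i j → F (suc i) j)

infixr 8 ∑-antidiag
syntax ∑-antidiag n (λ i j → e) = ∑[ i + j ≡ n ] e

∑-antidiag-cong-on : ∀ n {F G} → (∀ i j → i ℕ.+ j ≡ n → F i j ≡ G i j) → ∑-antidiag n F ≡ ∑-antidiag n G
∑-antidiag-cong-on zero    eq = eq 0 0 refl
∑-antidiag-cong-on (suc n) eq =
  cong₂ _+_ (eq 0 (suc n) refl) (∑-antidiag-cong-on n (λ i j i+j≡n → eq (suc i) j (cong suc i+j≡n)))

∑-antidiag-cong : ∀ n {F G} → (∀ i j → F i j ≡ G i j) → ∑-antidiag n F ≡ ∑-antidiag n G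
∑-antidiag-cong n eq = ∑-antidiag-cong-on n (λ i j _ → eq i j)

∑-antidiag-0 : ∀ n → ∑[ i + j ≡ n ] 0ℤ ≡ 0ℤ
∑-antidiag-0 zero    = refl
∑-antidiag-0 (suc n) = trans (ℤP.+-identityˡ _) (∑-antidiag-0 n)

∑-antidiag-+ : ∀ n F G → ∑[ i + j ≡ n ] (F i j + G i j) ≡ ∑-antidiag n F + ∑-antidiag n G
∑-antidiag-+ zero    F G = refl
∑-antidiag-+ (suc n) F G =
  trans (cong (F 0 (suc n) + G 0 (suc n) +_) (∑-antidiag-+ n (λ i j → F (suc i) j) (λ i j → G (suc i) j)))
        (interchange (F 0 (suc n)) (G 0 (suc n)) _ _)
  where
  interchange : ∀ a b c d → a + b + (c + d) ≡ a + c + (b + d)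
  interchange = solve-∀

∑-antidiag-neg : ∀ n F → ∑[ i + j ≡ n ] (- F i j) ≡ - ∑-antidiag n F
∑-antidiag-neg zero    F = refl
∑-antidiag-neg (suc n) F =
  trans (cong (- F 0 (suc n) +_) (∑-antidiag-neg n (λ i j → F (suc i) j)))
        (sym (ℤP.neg-distrib-+ (F 0 (suc n)) _))

∑-antidiag-when : ∀ n b F → ∑[ i + j ≡ n ] when b (F i j) ≡ when b (∑-antidiag n F)
∑-antidiag-when n true  F = refl
∑-antidiag-when n false F = ∑-antidiag-0 n

∑-antidiag-∑ : ∀ {A : Set} n (L : List A) (F : ℕ → ℕ → A → ℤ) →
  ∑[ i + j ≡ n ] ∑[ x ← L ] F i j x ≡ ∑[ x ← L ] ∑[ i + j ≡ n ] F i j x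
∑-antidiag-∑ n []      F = ∑-antidiag-0 n
∑-antidiag-∑ n (x ∷ L) F = trans (∑-antidiag-+ n (λ i j → F i j x) (λ i j → ∑-list L (F i j)))
                                 (cong (∑-antidiag n (λ i j → F i j x) +_) (∑-antidiag-∑ n L F))

∑-antidiag-head : ∀ n F → (∀ i j → F (suc i) j ≡ 0ℤ) → ∑-antidiag n F ≡ F 0 n
∑-antidiag-head zero    F vanish = refl
∑-antidiag-head (suc n) F vanish =
  trans (cong (F 0 (suc n) +_) (trans (∑-antidiag-cong n vanish) (∑-antidiag-0 n))) (ℤP.+-identityʳ _)

∑-applyUpTo-antidiag : ∀ n F → sumℤ (applyUpTo (λ i → F i (n ∸ i)) (suc n)) ≡ ∑-antidiag n F
∑-applyUpTo-antidiag zero    F = ℤP.+-identityʳ _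
∑-applyUpTo-antidiag (suc n) F = cong (F 0 (suc n) +_) (∑-applyUpTo-antidiag n (λ i j → F (suc i) j))

∑-list-antidiag : ∀ n f → ∑-list (antidiag n) f ≡ ∑[ i + j ≡ n ] f (i , j)
∑-list-antidiag n f = begin
  sumℤ (map f (map (λ i → i , n ∸ i) (applyUpTo (λ i → i) (suc n))))
    ≡⟨ cong sumℤ (sym (map-∘ {g = f} {f = λ i → i , n ∸ i} (applyUpTo (λ i → i) (suc n)))) ⟩
  sumℤ (map (λ i → f (i , n ∸ i)) (applyUpTo (λ i → i) (suc n)))
    ≡⟨ cong sumℤ (map-applyUpTo (λ i → i) (λ i → f (i , n ∸ i)) (suc n)) ⟩
  sumℤ (applyUpTo (λ i → f (i , n ∸ i)) (suc n))
    ≡⟨ ∑-applyUpTo-antidiag n (λ i j → f (i , j)) ⟩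
  ∑[ i + j ≡ n ] f (i , j)
    ∎

when-≤ᵇ : ∀ j a x c → when (j ≤ᵇ a) (when (a ∸ j ≡ᵇ x) c) ≡ when (a ≡ᵇ j ℕ.+ x) c
when-≤ᵇ zero          a       x c = refl
when-≤ᵇ (suc j)       zero    x c = refl
when-≤ᵇ (suc zero)    (suc a) x c = refl
when-≤ᵇ (suc (suc j)) (suc a) x c = when-≤ᵇ (suc j) a x c

∑-antidiag-delta : ∀ n c (H : ℕ → ℤ) → ∑[ p + q ≡ n ] when (p ≡ᵇ c) (H q) ≡ when (c ≤ᵇ n) (H (n ∸ c))
∑-antidiag-delta zero    zero          H = refl
∑-antidiag-delta zero    (suc c)       H = refl
∑-antidiag-delta (suc n) zero          H = trans (cong (H (suc n) +_) (∑-antidiag-0 n)) (ℤP.+-identityʳ _)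
∑-antidiag-delta (suc n) (suc zero)    H = trans (ℤP.+-identityˡ _) (∑-antidiag-delta n zero H)
∑-antidiag-delta (suc n) (suc (suc c)) H = trans (ℤP.+-identityˡ _) (∑-antidiag-delta n (suc c) H)

∑-antidiag-delta₂ : ∀ n α γ X → ∑[ p + q ≡ n ] when (p ≡ᵇ α) (when (q ≡ᵇ γ) X) ≡ when (n ≡ᵇ α ℕ.+ γ) X
∑-antidiag-delta₂ n α γ X = trans (∑-antidiag-delta n α (λ q → when (q ≡ᵇ γ) X)) (when-≤ᵇ α n γ X)

⊛-coeff : ∀ F G n a b →
  (F ⊛ G) n a b ≡ ∑[ i + i' ≡ n ] ∑[ j + j' ≡ a ] ∑[ k + k' ≡ b ] (F i j k * G i' j' k')
⊛-coeff F G n a b =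
  trans (∑-list-antidiag n _) (∑-antidiag-cong n λ i i' →
    trans (∑-list-antidiag a _) (∑-antidiag-cong a λ j j' →
      ∑-list-antidiag b (λ { (k , k') → F i j k * G i' j' k' })))

∑³ : ℕ → ℕ → ℕ → (ℕ → ℕ → ℕ → ℕ → ℕ → ℕ → ℤ) → ℤ
∑³ n a b T = ∑[ i + i' ≡ n ] ∑[ j + j' ≡ a ] ∑[ k + k' ≡ b ] T i i' j j' k k'

∑³-cong : ∀ n a b {T T′} → (∀ i i' j j' k k' → T i i' j j' k k' ≡ T′ i i' j j' k k') →
  ∑³ n a b T ≡ ∑³ n a b T′
∑³-cong n a b eq =
  ∑-antidiag-cong n λ i i' → ∑-antidiag-cong a λ j j' → ∑-antidiag-cong b λ k k' → eq i i' j j' k k'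

∑³-+ : ∀ n a b T T′ →
  ∑³ n a b (λ i i' j j' k k' → T i i' j j' k k' + T′ i i' j j' k k') ≡ ∑³ n a b T + ∑³ n a b T′
∑³-+ n a b T T′ =
  trans (∑-antidiag-cong n λ i i' →
           trans (∑-antidiag-cong a λ j j' → ∑-antidiag-+ b (T i i' j j') (T′ i i' j j'))
                 (∑-antidiag-+ a (λ j j' → ∑-antidiag b (T i i' j j')) (λ j j' → ∑-antidiag b (T′ i i' j j'))))
        (∑-antidiag-+ n (λ i i' → ∑[ j + j' ≡ a ] ∑-antidiag b (T i i' j j'))
                        (λ i i' → ∑[ j + j' ≡ a ] ∑-antidiag b (T′ i i' j j')))

∑³-neg : ∀ n a b T → ∑³ n a b (λ i i' j j' k k' → - T i i' j j' k k') ≡ - ∑³ n a b T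
∑³-neg n a b T =
  trans (∑-antidiag-cong n λ i i' →
           trans (∑-antidiag-cong a λ j j' → ∑-antidiag-neg b (T i i' j j'))
                 (∑-antidiag-neg a (λ j j' → ∑-antidiag b (T i i' j j'))))
        (∑-antidiag-neg n (λ i i' → ∑[ j + j' ≡ a ] ∑-antidiag b (T i i' j j')))

⊛-congˡ : ∀ {F F′} G → F ≈ F′ → F ⊛ G ≈ F′ ⊛ G
⊛-congˡ {F} {F′} G eq n a b =
  trans (⊛-coeff F G n a b)
        (trans (∑³-cong n a b λ i i' j j' k k' → cong (_* G i' j' k') (eq i j k))
               (sym (⊛-coeff F′ G n a b)))

⊛-distribʳ-⊕ : ∀ F F′ G → (F ⊕ F′) ⊛ G ≈ F ⊛ G ⊕ F′ ⊛ G
⊛-distribʳ-⊕ F F′ G n a b = begin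
  ((F ⊕ F′) ⊛ G) n a b
    ≡⟨ ⊛-coeff (F ⊕ F′) G n a b ⟩
  ∑³ n a b (λ i i' j j' k k' → (F i j k + F′ i j k) * G i' j' k')
    ≡⟨ ∑³-cong n a b (λ i i' j j' k k' → ℤP.*-distribʳ-+ (G i' j' k') (F i j k) (F′ i j k)) ⟩
  ∑³ n a b (λ i i' j j' k k' → F i j k * G i' j' k' + F′ i j k * G i' j' k')
    ≡⟨ ∑³-+ n a b _ _ ⟩
  ∑³ n a b (λ i i' j j' k k' → F i j k * G i' j' k') + ∑³ n a b (λ i i' j j' k k' → F′ i j k * G i' j' k')
    ≡⟨ sym (cong₂ _+_ (⊛-coeff F G n a b) (⊛-coeff F′ G n a b)) ⟩
  (F ⊛ G) n a b + (F′ ⊛ G) n a b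
    ∎

⊛-distribʳ-⊖ : ∀ F F′ G → (F ⊖ F′) ⊛ G ≈ F ⊛ G ⊖ F′ ⊛ G
⊛-distribʳ-⊖ F F′ G n a b = begin
  ((F ⊖ F′) ⊛ G) n a b
    ≡⟨ ⊛-coeff (F ⊖ F′) G n a b ⟩
  ∑³ n a b (λ i i' j j' k k' → (F i j k - F′ i j k) * G i' j' k')
    ≡⟨ ∑³-cong n a b (λ i i' j j' k k' → *-distribʳ-- (F i j k) (F′ i j k) (G i' j' k')) ⟩
  ∑³ n a b (λ i i' j j' k k' → F i j k * G i' j' k' + - (F′ i j k * G i' j' k'))
    ≡⟨ ∑³-+ n a b _ _ ⟩
  ∑³ n a b (λ i i' j j' k k' → F i j k * G i' j' k') + ∑³ n a b (λ i i' j j' k k' → - (F′ i j k * G i' j' k'))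
    ≡⟨ cong (∑³ n a b (λ i i' j j' k k' → F i j k * G i' j' k') +_)
            (∑³-neg n a b (λ i i' j j' k k' → F′ i j k * G i' j' k')) ⟩
  ∑³ n a b (λ i i' j j' k k' → F i j k * G i' j' k') - ∑³ n a b (λ i i' j j' k k' → F′ i j k * G i' j' k')
    ≡⟨ sym (cong₂ _-_ (⊛-coeff F G n a b) (⊛-coeff F′ G n a b)) ⟩
  (F ⊛ G) n a b - (F′ ⊛ G) n a b
    ∎
  where
  *-distribʳ-- : ∀ x y z → (x - y) * z ≡ x * z + - (y * z)
  *-distribʳ-- = solve-∀

mono-* : ∀ i j k p q r X → mono i j k p q r * X ≡ when (p ≡ᵇ i) (when (q ≡ᵇ j) (when (r ≡ᵇ k) X))
mono-* i j k p q r X with p ≡ᵇ i | q ≡ᵇ j | r ≡ᵇ k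
... | true  | true  | true  = ℤP.*-identityˡ X
... | true  | true  | false = ℤP.*-zeroˡ X
... | true  | false | _     = ℤP.*-zeroˡ X
... | false | _     | _     = ℤP.*-zeroˡ X

mono-⊛ : ∀ i j k G n a b →
  (mono i j k ⊛ G) n a b ≡ when (i ≤ᵇ n) (when (j ≤ᵇ a) (when (k ≤ᵇ b) (G (n ∸ i) (a ∸ j) (b ∸ k))))
mono-⊛ i j k G n a b = begin
  (mono i j k ⊛ G) n a b
    ≡⟨ ⊛-coeff (mono i j k) G n a b ⟩
  ∑[ p + p' ≡ n ] ∑[ q + q' ≡ a ] ∑[ r + r' ≡ b ] (mono i j k p q r * G p' q' r')
    ≡⟨ ∑³-cong n a b (λ p p' q q' r r' → mono-* i j k p q r (G p' q' r')) ⟩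
  ∑[ p + p' ≡ n ] ∑[ q + q' ≡ a ] ∑[ r + r' ≡ b ] when (p ≡ᵇ i) (when (q ≡ᵇ j) (when (r ≡ᵇ k) (G p' q' r')))
    ≡⟨ (∑-antidiag-cong n λ p p' → ∑-antidiag-cong a λ q q' →
          trans (∑-antidiag-when b (p ≡ᵇ i) _) (cong (when (p ≡ᵇ i))
            (trans (∑-antidiag-when b (q ≡ᵇ j) _) (cong (when (q ≡ᵇ j)) (∑-antidiag-delta b k (G p' q')))))) ⟩
  ∑[ p + p' ≡ n ] ∑[ q + q' ≡ a ] when (p ≡ᵇ i) (when (q ≡ᵇ j) (when (k ≤ᵇ b) (G p' q' (b ∸ k))))
    ≡⟨ (∑-antidiag-cong n λ p p' →
          trans (∑-antidiag-when a (p ≡ᵇ i) _) (cong (when (p ≡ᵇ i)) (∑-antidiag-delta a j _))) ⟩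
  ∑[ p + p' ≡ n ] when (p ≡ᵇ i) (when (j ≤ᵇ a) (when (k ≤ᵇ b) (G p' (a ∸ j) (b ∸ k))))
    ≡⟨ ∑-antidiag-delta n i _ ⟩
  when (i ≤ᵇ n) (when (j ≤ᵇ a) (when (k ≤ᵇ b) (G (n ∸ i) (a ∸ j) (b ∸ k))))
    ∎

rS⊛sS : rS ⊛ sS ≈ mono 1 0 1
rS⊛sS n a b = trans (mono-⊛ 1 0 0 sS n a b) (shifted n)
  where
  shifted : ∀ n → when (1 ≤ᵇ n) (sS (n ∸ 1) a b) ≡ mono 1 0 1 n a b
  shifted zero    = refl
  shifted (suc n) = refl

rs⊛[m-1] : mono 1 0 1 ⊛ (mS ⊖ oneS) ≈ mono 1 1 1 ⊖ mono 1 0 1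
rs⊛[m-1] n a b = trans (mono-⊛ 1 0 1 (mS ⊖ oneS) n a b) (shifted n b)
  where
  vanish : ∀ x y → (if x ∧ y ∧ false then 1ℤ else 0ℤ) ≡ 0ℤ
  vanish true  true  = refl
  vanish true  false = refl
  vanish false y     = refl
  shifted : ∀ n b → when (1 ≤ᵇ n) (when (1 ≤ᵇ b) ((mS ⊖ oneS) (n ∸ 1) a (b ∸ 1))) ≡ (mono 1 1 1 ⊖ mono 1 0 1) n a b
  shifted zero    b       = refl
  shifted (suc n) zero    = sym (cong₂ _-_ (vanish (n ≡ᵇ 0) (a ≡ᵇ 1)) (vanish (n ≡ᵇ 0) (a ≡ᵇ 0)))
  shifted (suc n) (suc b) = refl

correction : Series → Series
correction χ = mono 1 1 1 ⊛ χ ⊖ mono 1 0 1 ⊛ χ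

f-rs⊛ : ∀ χ n a b → (f-rs ⊛ χ) n a b ≡ χ n a b + correction χ n a b
f-rs⊛ χ n a b = begin
  (f-rs ⊛ χ) n a b
    ≡⟨ ⊛-distribʳ-⊕ oneS ((rS ⊛ sS) ⊛ (mS ⊖ oneS)) χ n a b ⟩
  (oneS ⊛ χ) n a b + (((rS ⊛ sS) ⊛ (mS ⊖ oneS)) ⊛ χ) n a b
    ≡⟨ cong₂ _+_ (mono-⊛ 0 0 0 χ n a b) (⊛-congˡ χ (⊛-congˡ (mS ⊖ oneS) rS⊛sS) n a b) ⟩
  χ n a b + ((mono 1 0 1 ⊛ (mS ⊖ oneS)) ⊛ χ) n a b
    ≡⟨ cong (χ n a b +_) (trans (⊛-congˡ χ rs⊛[m-1] n a b) (⊛-distribʳ-⊖ (mono 1 1 1) (mono 1 0 1) χ n a b)) ⟩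
  χ n a b + correction χ n a b
    ∎

correction-zero : ∀ χ a b → correction χ 0 a b ≡ 0ℤ
correction-zero χ a b = cong₂ _-_ (mono-⊛ 1 1 1 χ 0 a b) (mono-⊛ 1 0 1 χ 0 a b)

correction-suc : ∀ χ m a b →
  correction χ (suc m) a b ≡ when (1 ≤ᵇ a) (when (1 ≤ᵇ b) (χ m (a ∸ 1) (b ∸ 1))) - when (1 ≤ᵇ b) (χ m a (b ∸ 1))
correction-suc χ m a b = cong₂ _-_ (mono-⊛ 1 1 1 χ (suc m) a b) (mono-⊛ 1 0 1 χ (suc m) a b)

rsSubst : Series → Series
rsSubst χ = mono 1 0 1 ⊛ substRS χ

substRS-when : ∀ F n a b → substRS F n a b ≡ when (n ≤ᵇ b) (F n a (b ∸ n))
substRS-when F n a b = guard n b (F n a (b ∸ n))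
  where
  guard : ∀ n b X → (if suc b ∸ n ≡ᵇ 0 then 0ℤ else X) ≡ when (n ≤ᵇ b) X
  guard zero          b       X = refl
  guard (suc zero)    zero    X = refl
  guard (suc (suc n)) zero    X = refl
  guard (suc zero)    (suc b) X = refl
  guard (suc (suc n)) (suc b) X = guard (suc n) b X

rsSubst-zero : ∀ χ j k → rsSubst χ 0 j k ≡ 0ℤ
rsSubst-zero χ j k = mono-⊛ 1 0 1 (substRS χ) 0 j k

rsSubst-suc : ∀ χ i j k → rsSubst χ (suc i) j k ≡ when (1 ≤ᵇ k) (when (i ≤ᵇ k ∸ 1) (χ i j (k ∸ 1 ∸ i)))
rsSubst-suc χ i j k =
  trans (mono-⊛ 1 0 1 (substRS χ) (suc i) j k) (cong (when (1 ≤ᵇ k)) (substRS-when χ i j (k ∸ 1)))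

∑²-rsSubst-zero : ∀ ψ (G : ℕ → ℕ → ℤ) a b → ∑[ j + j' ≡ a ] ∑[ k + k' ≡ b ] (rsSubst ψ 0 j k * G j' k') ≡ 0ℤ
∑²-rsSubst-zero ψ G a b =
  trans (∑-antidiag-cong a λ j j' → ∑-antidiag-cong b λ k k' →
           trans (cong (_* G j' k') (rsSubst-zero ψ j k)) (ℤP.*-zeroˡ (G j' k')))
        (trans (∑-antidiag-cong a (λ _ _ → ∑-antidiag-0 b)) (∑-antidiag-0 a))

rsSubst⊛-zero : ∀ ψ φ a b → (rsSubst ψ ⊛ φ) 0 a b ≡ 0ℤ
rsSubst⊛-zero ψ φ a b = trans (⊛-coeff (rsSubst ψ) φ 0 a b) (∑²-rsSubst-zero ψ (φ 0) a b)

rsSubst⊛-suc : ∀ ψ φ m a b →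
  (rsSubst ψ ⊛ φ) (suc m) a b ≡ ∑[ i + i' ≡ m ] ∑[ j + j' ≡ a ] ∑[ k + k' ≡ b ] (rsSubst ψ (suc i) j k * φ i' j' k')
rsSubst⊛-suc ψ φ m a b =
  trans (⊛-coeff (rsSubst ψ) φ (suc m) a b)
        (trans (cong (_+ ∑[ i + i' ≡ m ] ∑[ j + j' ≡ a ] ∑[ k + k' ≡ b ] (rsSubst ψ (suc i) j k * φ i' j' k'))
                     (∑²-rsSubst-zero ψ (φ (suc m)) a b))
               (ℤP.+-identityˡ _))

quadratic≈ : ∀ χ → rS ⊛ sS ⊛ substRS χ ⊛ χ ≈ rsSubst χ ⊛ χ
quadratic≈ χ = ⊛-congˡ χ (⊛-congˡ (substRS χ) rS⊛sS)

Recurrence : Series → Set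
Recurrence χ = ∀ n a b → χ n a b + correction χ n a b ≡ oneS n a b - (rsSubst χ ⊛ χ) n a b

FunEq⇒Recurrence : ∀ {χ} → FunEq χ → Recurrence χ
FunEq⇒Recurrence {χ} eq n a b =
  trans (sym (f-rs⊛ χ n a b)) (trans (eq n a b) (cong (λ q → oneS n a b - q) (quadratic≈ χ n a b)))

Recurrence⇒FunEq : ∀ {χ} → Recurrence χ → FunEq χ
Recurrence⇒FunEq {χ} rec n a b =
  trans (f-rs⊛ χ n a b) (trans (rec n a b) (cong (λ q → oneS n a b - q) (sym (quadratic≈ χ n a b))))

-- Uniqueness

AgreeBelow : Series → Series → ℕ → Set
AgreeBelow ψ φ n = ∀ {i} → i < n → ∀ a b → ψ i a b ≡ φ i a b

correction-agree : ∀ {ψ φ} n → AgreeBelow ψ φ n → ∀ a b → correction ψ n a b ≡ correction φ n a b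
correction-agree {ψ} {φ} zero    agree a b = trans (correction-zero ψ a b) (sym (correction-zero φ a b))
correction-agree {ψ} {φ} (suc m) agree a b = begin
  correction ψ (suc m) a b
    ≡⟨ correction-suc ψ m a b ⟩
  when (1 ≤ᵇ a) (when (1 ≤ᵇ b) (ψ m (a ∸ 1) (b ∸ 1))) - when (1 ≤ᵇ b) (ψ m a (b ∸ 1))
    ≡⟨ cong₂ (λ x y → when (1 ≤ᵇ a) (when (1 ≤ᵇ b) x) - when (1 ≤ᵇ b) y)
             (agree ℕP.≤-refl (a ∸ 1) (b ∸ 1)) (agree ℕP.≤-refl a (b ∸ 1)) ⟩
  when (1 ≤ᵇ a) (when (1 ≤ᵇ b) (φ m (a ∸ 1) (b ∸ 1))) - when (1 ≤ᵇ b) (φ m a (b ∸ 1))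
    ≡⟨ sym (correction-suc φ m a b) ⟩
  correction φ (suc m) a b
    ∎

-- rs χ(m, rs, s) χ has no r⁰ term, so its rⁿ coefficient only involves lower coefficients of χ.
quadratic-agree : ∀ {ψ φ} n → AgreeBelow ψ φ n → ∀ a b → (rsSubst ψ ⊛ ψ) n a b ≡ (rsSubst φ ⊛ φ) n a b
quadratic-agree {ψ} {φ} zero    agree a b = trans (rsSubst⊛-zero ψ ψ a b) (sym (rsSubst⊛-zero φ φ a b))
quadratic-agree {ψ} {φ} (suc m) agree a b =
  trans (rsSubst⊛-suc ψ ψ m a b)
        (trans (∑-antidiag-cong-on m (λ i i' i+i'≡m → ∑-antidiag-cong a λ j j' → ∑-antidiag-cong b λ k k' →
                  cong₂ _*_ (rsSubst-agree i j k (agree (i<suc[i+i'] i+i'≡m)))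
                            (agree (i'<suc[i+i'] i+i'≡m) j' k')))
               (sym (rsSubst⊛-suc φ φ m a b)))
  where
  i<suc[i+i'] : ∀ {i i'} → i ℕ.+ i' ≡ m → i < suc m
  i<suc[i+i'] {i} {i'} refl = s≤s (ℕP.m≤m+n i i')
  i'<suc[i+i'] : ∀ {i i'} → i ℕ.+ i' ≡ m → i' < suc m
  i'<suc[i+i'] {i} {i'} refl = s≤s (ℕP.m≤n+m i' i)
  rsSubst-agree : ∀ i j k → (∀ a b → ψ i a b ≡ φ i a b) → rsSubst ψ (suc i) j k ≡ rsSubst φ (suc i) j k
  rsSubst-agree i j k eq =
    trans (rsSubst-suc ψ i j k)
          (trans (cong (λ x → when (1 ≤ᵇ k) (when (i ≤ᵇ k ∸ 1) x)) (eq j (k ∸ 1 ∸ i)))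
                 (sym (rsSubst-suc φ i j k)))

Recurrence-unique : ∀ {ψ φ} → Recurrence ψ → Recurrence φ → ψ ≈ φ
Recurrence-unique {ψ} {φ} recψ recφ = <-rec (λ n → ∀ a b → ψ n a b ≡ φ n a b) step
  where
  isolate : ∀ {x c y} → x + c ≡ y → x ≡ y - c
  isolate {x} {c} eq = trans (sym (cancel x c)) (cong (_- c) eq)
    where
    cancel : ∀ x c → x + c - c ≡ x
    cancel = solve-∀
  step : ∀ n → AgreeBelow ψ φ n → ∀ a b → ψ n a b ≡ φ n a b
  step n agree a b = begin
    ψ n a b
      ≡⟨ isolate (recψ n a b) ⟩
    oneS n a b - (rsSubst ψ ⊛ ψ) n a b - correction ψ n a b
      ≡⟨ cong₂ (λ q c → oneS n a b - q - c) (quadratic-agree n agree a b) (correction-agree n agree a b) ⟩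
    oneS n a b - (rsSubst φ ⊛ φ) n a b - correction φ n a b
      ≡⟨ sym (isolate (recφ n a b)) ⟩
    φ n a b
      ∎

-- Sums over Dyck paths

pathSum : ℕ → ℕ → (List Step → ℤ) → ℤ
pathSum h k f = ∑[ w ← words k ] when (validFrom h w) (f w)

∑-words-suc : ∀ k f → ∑-list (words (suc k)) f ≡ ∑[ w ← words k ] f (U ∷ w) + ∑[ w ← words k ] f (D ∷ w)
∑-words-suc k f =
  trans (∑-++ (map (U ∷_) (words k)) (map (D ∷_) (words k)) f)
        (cong₂ _+_ (∑-map (words k) (U ∷_) f) (∑-map (words k) (D ∷_) f))

pathSum-0-suc : ∀ k f → pathSum 0 (suc k) f ≡ pathSum 1 k (λ w → f (U ∷ w))
pathSum-0-suc k f =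
  trans (∑-words-suc k _) (trans (cong (pathSum 1 k (λ w → f (U ∷ w)) +_) (∑-0 (words k))) (ℤP.+-identityʳ _))

pathSum-suc-suc : ∀ h k f →
  pathSum (suc h) (suc k) f ≡ pathSum (suc (suc h)) k (λ w → f (U ∷ w)) + pathSum h k (λ w → f (D ∷ w))
pathSum-suc-suc h k f = ∑-words-suc k _

pathSum-odd : ∀ h k f → parity (h ℕ.+ k) ≡ 1 → pathSum h k f ≡ 0ℤ
pathSum-odd (suc h) zero    f odd = refl
pathSum-odd zero    (suc k) f odd = trans (pathSum-0-suc k f) (pathSum-odd 1 k _ odd)
pathSum-odd (suc h) (suc k) f odd =
  trans (pathSum-suc-suc h k f) (cong₂ _+_ (pathSum-odd (suc (suc h)) k _ odd′) (pathSum-odd h k _ odd′))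
  where
  odd′ : parity (h ℕ.+ k) ≡ 1
  odd′ = trans (cong (parity ∘ suc) (sym (ℕP.+-suc h k))) odd

-- The first D step from height b + 1 to b splits the path.
pathSum-firstPassage : ∀ K a b f →
  pathSum (suc (a ℕ.+ b)) (suc K) f ≡ ∑[ p + q ≡ K ] pathSum a p (λ u → pathSum b q (λ v → f (u ++ D ∷ v)))
pathSum-firstPassage zero zero zero f = trans (ℤP.+-identityˡ (f (D ∷ []) + 0ℤ)) (sym (ℤP.+-identityʳ (f (D ∷ []) + 0ℤ)))
pathSum-firstPassage zero zero (suc b) f = refl
pathSum-firstPassage zero (suc a) b f = refl
pathSum-firstPassage (suc K) zero b f = begin
    pathSum (suc b) (suc (suc K)) f
  ≡⟨ pathSum-suc-suc b (suc K) f ⟩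
    pathSum (suc (suc b)) (suc K) (λ w → f (U ∷ w)) + pathSum b (suc K) (λ w → f (D ∷ w))
  ≡⟨ cong (_+ pathSum b (suc K) (λ w → f (D ∷ w))) (pathSum-firstPassage K 1 b (λ w → f (U ∷ w))) ⟩
    ∑[ p + q ≡ K ] pathSum 1 p (λ u → pathSum b q (λ v → f (U ∷ u ++ D ∷ v))) + pathSum b (suc K) (λ w → f (D ∷ w))
  ≡⟨ ℤP.+-comm (∑[ p + q ≡ K ] pathSum 1 p (λ u → pathSum b q (λ v → f (U ∷ u ++ D ∷ v))))
                (pathSum b (suc K) (λ w → f (D ∷ w))) ⟩
    pathSum b (suc K) (λ w → f (D ∷ w)) + ∑[ p + q ≡ K ] pathSum 1 p (λ u → pathSum b q (λ v → f (U ∷ u ++ D ∷ v)))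
  ≡⟨ cong₂ _+_ (sym (ℤP.+-identityʳ (pathSum b (suc K) (λ w → f (D ∷ w)))))
               (∑-antidiag-cong K λ p q → sym (pathSum-0-suc p (λ u → pathSum b q (λ v → f (u ++ D ∷ v))))) ⟩
    ∑[ p + q ≡ suc K ] pathSum 0 p (λ u → pathSum b q (λ v → f (u ++ D ∷ v)))
  ∎
pathSum-firstPassage (suc K) (suc a) b f = begin
    pathSum (suc (suc a ℕ.+ b)) (suc (suc K)) f
  ≡⟨ pathSum-suc-suc (suc a ℕ.+ b) (suc K) f ⟩
    pathSum (suc (suc (suc a ℕ.+ b))) (suc K) (λ w → f (U ∷ w)) + pathSum (suc a ℕ.+ b) (suc K) (λ w → f (D ∷ w))
  ≡⟨ cong₂ _+_ (pathSum-firstPassage K (suc (suc a)) b (λ w → f (U ∷ w)))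
               (pathSum-firstPassage K a b (λ w → f (D ∷ w))) ⟩
    ∑[ p + q ≡ K ] pathSum (suc (suc a)) p (λ u → pathSum b q (λ v → f (U ∷ u ++ D ∷ v)))
      + ∑[ p + q ≡ K ] pathSum a p (λ u → pathSum b q (λ v → f (D ∷ u ++ D ∷ v)))
  ≡⟨ sym (∑-antidiag-+ K _ _) ⟩
    ∑[ p + q ≡ K ] (pathSum (suc (suc a)) p (λ u → pathSum b q (λ v → f (U ∷ u ++ D ∷ v)))
                      + pathSum a p (λ u → pathSum b q (λ v → f (D ∷ u ++ D ∷ v))))
  ≡⟨ (∑-antidiag-cong K λ p q → sym (pathSum-suc-suc a p (λ u → pathSum b q (λ v → f (u ++ D ∷ v))))) ⟩
    ∑[ p + q ≡ K ] pathSum (suc a) (suc p) (λ u → pathSum b q (λ v → f (u ++ D ∷ v)))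
  ≡⟨ sym (ℤP.+-identityˡ _) ⟩
    ∑[ p + q ≡ suc K ] pathSum (suc a) p (λ u → pathSum b q (λ v → f (u ++ D ∷ v)))
  ∎

double : ℕ → ℕ
double zero    = zero
double (suc n) = suc (suc (double n))

2*n≡double : ∀ n → 2 ℕ.* n ≡ double n
2*n≡double zero    = refl
2*n≡double (suc n) = trans (cong suc (ℕP.+-suc n (n ℕ.+ 0))) (cong (suc ∘ suc) (2*n≡double n))

parity-odd : ∀ i → parity (suc (double i)) ≡ 1
parity-odd zero    = refl
parity-odd (suc i) = parity-odd i

∑-antidiag-double : ∀ m (F : ℕ → ℕ → ℤ) → (∀ i q → F (suc (double i)) q ≡ 0ℤ) →
  ∑[ p + q ≡ double m ] F p q ≡ ∑[ i + j ≡ m ] F (double i) (double j)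
∑-antidiag-double zero    F odd = refl
∑-antidiag-double (suc m) F odd = cong (F 0 (double (suc m)) +_) (begin
    F 1 (suc (double m)) + ∑[ p + q ≡ double m ] F (suc (suc p)) q
  ≡⟨ cong (_+ ∑[ p + q ≡ double m ] F (suc (suc p)) q) (odd 0 (suc (double m))) ⟩
    0ℤ + ∑[ p + q ≡ double m ] F (suc (suc p)) q
  ≡⟨ ℤP.+-identityˡ _ ⟩
    ∑[ p + q ≡ double m ] F (suc (suc p)) q
  ≡⟨ ∑-antidiag-double m (λ p q → F (suc (suc p)) q) (λ i → odd (suc i)) ⟩
    ∑[ i + j ≡ m ] F (double (suc i)) (double j)
  ∎)

∑-Dyck : ∀ n f → ∑-list (Dyck n) f ≡ pathSum 0 (double n) f
∑-Dyck n f = trans (∑-filterB isDyck (words (2 ℕ.* n)) f) (cong (λ k → pathSum 0 k f) (2*n≡double n))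

∑-Dyck-firstReturn : ∀ n f →
  ∑-list (Dyck (suc n)) f ≡ ∑[ i + j ≡ n ] ∑[ u ← Dyck i ] ∑[ v ← Dyck j ] f (U ∷ u ++ D ∷ v)
∑-Dyck-firstReturn n f = begin
    ∑-list (Dyck (suc n)) f
  ≡⟨ ∑-Dyck (suc n) f ⟩
    pathSum 0 (suc (suc (double n))) f
  ≡⟨ pathSum-0-suc (suc (double n)) f ⟩
    pathSum 1 (suc (double n)) (λ w → f (U ∷ w))
  ≡⟨ pathSum-firstPassage (double n) 0 0 (λ w → f (U ∷ w)) ⟩
    ∑[ p + q ≡ double n ] pathSum 0 p (λ u → pathSum 0 q (λ v → f (U ∷ u ++ D ∷ v)))
  ≡⟨ ∑-antidiag-double n (λ p q → pathSum 0 p (λ u → pathSum 0 q (λ v → f (U ∷ u ++ D ∷ v))))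
                          (λ i q → pathSum-odd 0 (suc (double i)) _ (parity-odd i)) ⟩
    ∑[ i + j ≡ n ] pathSum 0 (double i) (λ u → pathSum 0 (double j) (λ v → f (U ∷ u ++ D ∷ v)))
  ≡⟨ (∑-antidiag-cong n λ i j → sym (trans (∑-Dyck i _) (∑-cong (words (double i)) λ u →
        cong (when (validFrom 0 u)) (∑-Dyck j (λ v → f (U ∷ u ++ D ∷ v)))))) ⟩
    ∑[ i + j ≡ n ] ∑[ u ← Dyck i ] ∑[ v ← Dyck j ] f (U ∷ u ++ D ∷ v)
  ∎

-- Existence

-- The coefficient of m^a s^b in c · Σ_{x ∈ L} m^(α x) s^(β x).
gfCoeff : {A : Set} → List A → (A → ℕ) → (A → ℕ) → ℤ → ℕ → ℕ → ℤ
gfCoeff L α β c a b = ∑[ x ← L ] when (a ≡ᵇ α x) (when (b ≡ᵇ β x) c)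

dyckSeries-gf : ∀ n a b → dyckSeries n a b ≡ gfCoeff (Dyck n) Peak (sDegree n) (sign n) a b
dyckSeries-gf n a b = ∑-cong (Dyck n) (λ μ → when-∧ (a ≡ᵇ Peak μ) (b ≡ᵇ sDegree n μ) (sign n))

gfCoeff-shift : ∀ {A : Set} (L : List A) α β c j k a b →
  when (j ≤ᵇ a) (when (k ≤ᵇ b) (gfCoeff L α β c (a ∸ j) (b ∸ k)))
    ≡ gfCoeff L (λ x → j ℕ.+ α x) (λ x → k ℕ.+ β x) c a b
gfCoeff-shift L α β c j k a b = begin
    when (j ≤ᵇ a) (when (k ≤ᵇ b) (gfCoeff L α β c (a ∸ j) (b ∸ k)))
  ≡⟨ cong (when (j ≤ᵇ a)) (sym (∑-when L (k ≤ᵇ b) _)) ⟩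
    when (j ≤ᵇ a) (∑[ x ← L ] when (k ≤ᵇ b) (when (a ∸ j ≡ᵇ α x) (when (b ∸ k ≡ᵇ β x) c)))
  ≡⟨ sym (∑-when L (j ≤ᵇ a) _) ⟩
    ∑[ x ← L ] when (j ≤ᵇ a) (when (k ≤ᵇ b) (when (a ∸ j ≡ᵇ α x) (when (b ∸ k ≡ᵇ β x) c)))
  ≡⟨ (∑-cong L λ x → begin
        when (j ≤ᵇ a) (when (k ≤ᵇ b) (when (a ∸ j ≡ᵇ α x) (when (b ∸ k ≡ᵇ β x) c)))
      ≡⟨ cong (when (j ≤ᵇ a)) (when-comm (k ≤ᵇ b) (a ∸ j ≡ᵇ α x) _) ⟩
        when (j ≤ᵇ a) (when (a ∸ j ≡ᵇ α x) (when (k ≤ᵇ b) (when (b ∸ k ≡ᵇ β x) c)))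
      ≡⟨ when-≤ᵇ j a (α x) _ ⟩
        when (a ≡ᵇ j ℕ.+ α x) (when (k ≤ᵇ b) (when (b ∸ k ≡ᵇ β x) c))
      ≡⟨ cong (when (a ≡ᵇ j ℕ.+ α x)) (when-≤ᵇ k b (β x) c) ⟩
        when (a ≡ᵇ j ℕ.+ α x) (when (b ≡ᵇ k ℕ.+ β x) c)
      ∎) ⟩
    gfCoeff L (λ x → j ℕ.+ α x) (λ x → k ℕ.+ β x) c a b
  ∎

when²-*-when² : ∀ p q p′ q′ c d →
  when p (when q c) * when p′ (when q′ d) ≡ when p (when p′ (when q (when q′ (c * d))))
when²-*-when² false q     p′    q′    c d = ℤP.*-zeroˡ (when p′ (when q′ d))
when²-*-when² true  false p′    q′    c d = trans (ℤP.*-zeroˡ (when p′ (when q′ d))) (sym (when-0 p′))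
when²-*-when² true  true  false q′    c d = ℤP.*-zeroʳ c
when²-*-when² true  true  true  false c d = ℤP.*-zeroʳ c
when²-*-when² true  true  true  true  c d = refl

gfCoeff-product : ∀ {A B : Set} (L : List A) (M : List B) α β γ δ c d a b →
  ∑[ j + j' ≡ a ] ∑[ k + k' ≡ b ] (gfCoeff L α β c j k * gfCoeff M γ δ d j' k')
    ≡ ∑[ x ← L ] ∑[ y ← M ] when (a ≡ᵇ α x ℕ.+ γ y) (when (b ≡ᵇ β x ℕ.+ δ y) (c * d))
gfCoeff-product L M α β γ δ c d a b = begin
    ∑[ j + j' ≡ a ] ∑[ k + k' ≡ b ] (gfCoeff L α β c j k * gfCoeff M γ δ d j' k')
  ≡⟨ (∑-antidiag-cong a λ j j' → ∑-antidiag-cong b λ k k' → ∑-*-∑ L M _ _) ⟩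
    ∑[ j + j' ≡ a ] ∑[ k + k' ≡ b ] ∑[ x ← L ] ∑[ y ← M ] (monoˣ x j k * monoʸ y j' k')
  ≡⟨ (∑-antidiag-cong a λ j j' → trans (∑-antidiag-∑ b L _) (∑-cong L λ x → ∑-antidiag-∑ b M _)) ⟩
    ∑[ j + j' ≡ a ] ∑[ x ← L ] ∑[ y ← M ] ∑[ k + k' ≡ b ] (monoˣ x j k * monoʸ y j' k')
  ≡⟨ trans (∑-antidiag-∑ a L _) (∑-cong L λ x → ∑-antidiag-∑ a M _) ⟩
    ∑[ x ← L ] ∑[ y ← M ] ∑[ j + j' ≡ a ] ∑[ k + k' ≡ b ] (monoˣ x j k * monoʸ y j' k')
  ≡⟨ (∑-cong L λ x → ∑-cong M λ y → product x y) ⟩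
    ∑[ x ← L ] ∑[ y ← M ] when (a ≡ᵇ α x ℕ.+ γ y) (when (b ≡ᵇ β x ℕ.+ δ y) (c * d))
  ∎
  where
  monoˣ = λ x j k → when (j ≡ᵇ α x) (when (k ≡ᵇ β x) c)
  monoʸ = λ y j k → when (j ≡ᵇ γ y) (when (k ≡ᵇ δ y) d)
  product : ∀ x y → ∑[ j + j' ≡ a ] ∑[ k + k' ≡ b ] (monoˣ x j k * monoʸ y j' k')
                      ≡ when (a ≡ᵇ α x ℕ.+ γ y) (when (b ≡ᵇ β x ℕ.+ δ y) (c * d))
  product x y = begin
      ∑[ j + j' ≡ a ] ∑[ k + k' ≡ b ] (monoˣ x j k * monoʸ y j' k')
    ≡⟨ (∑-antidiag-cong a λ j j' → ∑-antidiag-cong b λ k k' →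
          when²-*-when² (j ≡ᵇ α x) (k ≡ᵇ β x) (j' ≡ᵇ γ y) (k' ≡ᵇ δ y) c d) ⟩
      ∑[ j + j' ≡ a ] ∑[ k + k' ≡ b ]
        when (j ≡ᵇ α x) (when (j' ≡ᵇ γ y) (when (k ≡ᵇ β x) (when (k' ≡ᵇ δ y) (c * d))))
    ≡⟨ (∑-antidiag-cong a λ j j' →
          trans (∑-antidiag-when b (j ≡ᵇ α x) _) (cong (when (j ≡ᵇ α x))
            (trans (∑-antidiag-when b (j' ≡ᵇ γ y) _)
                   (cong (when (j' ≡ᵇ γ y)) (∑-antidiag-delta₂ b (β x) (δ y) (c * d)))))) ⟩
      ∑[ j + j' ≡ a ] when (j ≡ᵇ α x) (when (j' ≡ᵇ γ y) (when (b ≡ᵇ β x ℕ.+ δ y) (c * d)))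
    ≡⟨ ∑-antidiag-delta₂ a (α x) (γ y) _ ⟩
      when (a ≡ᵇ α x ℕ.+ γ y) (when (b ≡ᵇ β x ℕ.+ δ y) (c * d))
    ∎

rsSubst-dyckSeries : ∀ i j k →
  rsSubst dyckSeries (suc i) j k ≡ gfCoeff (Dyck i) Peak (λ u → suc (i ℕ.+ sDegree i u)) (sign i) j k
rsSubst-dyckSeries i j k = begin
    rsSubst dyckSeries (suc i) j k
  ≡⟨ rsSubst-suc dyckSeries i j k ⟩
    when (1 ≤ᵇ k) (when (i ≤ᵇ k ∸ 1) (dyckSeries i j (k ∸ 1 ∸ i)))
  ≡⟨ cong (λ x → when (1 ≤ᵇ k) (when (i ≤ᵇ k ∸ 1) x)) (dyckSeries-gf i j (k ∸ 1 ∸ i)) ⟩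
    when (1 ≤ᵇ k) (when (i ≤ᵇ k ∸ 1) (gfCoeff (Dyck i) Peak (sDegree i) (sign i) j (k ∸ 1 ∸ i)))
  ≡⟨ cong (when (1 ≤ᵇ k)) (gfCoeff-shift (Dyck i) Peak (sDegree i) (sign i) 0 i j (k ∸ 1)) ⟩
    when (1 ≤ᵇ k) (gfCoeff (Dyck i) Peak (λ u → i ℕ.+ sDegree i u) (sign i) j (k ∸ 1))
  ≡⟨ gfCoeff-shift (Dyck i) Peak (λ u → i ℕ.+ sDegree i u) (sign i) 0 1 j k ⟩
    gfCoeff (Dyck i) Peak (λ u → suc (i ℕ.+ sDegree i u)) (sign i) j k
  ∎

-- The m^a s^b coefficients of m s χₘ and s χₘ, where χₘ is the coefficient of r^m in dyckSeries.
msDyck sDyck : ℕ → ℕ → ℕ → ℤ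
msDyck m = gfCoeff (Dyck m) (suc ∘ Peak) (suc ∘ sDegree m) (sign m)
sDyck  m = gfCoeff (Dyck m) Peak (suc ∘ sDegree m) (sign m)

correction-dyckSeries : ∀ m a b → correction dyckSeries (suc m) a b ≡ msDyck m a b - sDyck m a b
correction-dyckSeries m a b = begin
    correction dyckSeries (suc m) a b
  ≡⟨ correction-suc dyckSeries m a b ⟩
    when (1 ≤ᵇ a) (when (1 ≤ᵇ b) (dyckSeries m (a ∸ 1) (b ∸ 1))) - when (1 ≤ᵇ b) (dyckSeries m a (b ∸ 1))
  ≡⟨ cong₂ (λ x y → when (1 ≤ᵇ a) (when (1 ≤ᵇ b) x) - when (1 ≤ᵇ b) y)
           (dyckSeries-gf m (a ∸ 1) (b ∸ 1)) (dyckSeries-gf m a (b ∸ 1)) ⟩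
    when (1 ≤ᵇ a) (when (1 ≤ᵇ b) (gfCoeff (Dyck m) Peak (sDegree m) (sign m) (a ∸ 1) (b ∸ 1)))
      - when (1 ≤ᵇ b) (gfCoeff (Dyck m) Peak (sDegree m) (sign m) a (b ∸ 1))
  ≡⟨ cong₂ _-_ (gfCoeff-shift (Dyck m) Peak (sDegree m) (sign m) 1 1 a b)
               (gfCoeff-shift (Dyck m) Peak (sDegree m) (sign m) 0 1 a b) ⟩
    msDyck m a b - sDyck m a b
  ∎

sign-+ : ∀ i j → sign (i ℕ.+ j) ≡ sign i * sign j
sign-+ zero    j = sym (ℤP.*-identityˡ _)
sign-+ (suc i) j = trans (cong -_ (sign-+ i j)) (ℤP.neg-distribˡ-* (sign i) (sign j))

when²-inverse : ∀ x y c → when x (when y (- c)) + when x (when y c) ≡ 0ℤ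
when²-inverse true  true  c = ℤP.+-inverseˡ c
when²-inverse true  false c = refl
when²-inverse false y     c = refl

nilIndicator-Dyck-suc : ∀ i {u} → u ∈ Dyck (suc i) → nilIndicator u ≡ 0
nilIndicator-Dyck-suc i {u} u∈ = nonempty u (proj₂ (∈-Dyck (suc i) u∈))
  where
  nonempty : ∀ u {n} → length u ≡ suc n → nilIndicator u ≡ 0
  nonempty (_ ∷ _) _ = refl

module _ (a b : ℕ) where

  pairTerm : ℕ → ℤ → ℕ → ℕ → List Step → List Step → ℤ
  pairTerm p c i j u v = when (a ≡ᵇ p ℕ.+ (Peak u ℕ.+ Peak v)) (when (b ≡ᵇ suc (i ℕ.+ sDegree i u) ℕ.+ sDegree j v) c)

  dyckSeries-firstReturn : ∀ m → dyckSeries (suc m) a b ≡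
    ∑[ i + j ≡ m ] ∑[ u ← Dyck i ] ∑[ v ← Dyck j ] pairTerm (nilIndicator u) (- (sign i * sign j)) i j u v
  dyckSeries-firstReturn m =
    trans (dyckSeries-gf (suc m) a b)
          (trans (∑-Dyck-firstReturn m (summand (suc m)))
                 (∑-antidiag-cong-on m λ i j i+j≡m → ∑-cong-∈ (Dyck i) λ u u∈ → ∑-cong-∈ (Dyck j) λ v v∈ →
                    trans (cong (λ n → summand (suc n) (U ∷ u ++ D ∷ v)) (sym i+j≡m)) (summand-firstReturn i j u∈ v∈)))
    where
    summand : ℕ → List Step → ℤ
    summand n μ = when (a ≡ᵇ Peak μ) (when (b ≡ᵇ sDegree n μ) (sign n))
    summand-firstReturn : ∀ i j {u v} → u ∈ Dyck i → v ∈ Dyck j →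
      summand (suc (i ℕ.+ j)) (U ∷ u ++ D ∷ v) ≡ pairTerm (nilIndicator u) (- (sign i * sign j)) i j u v
    summand-firstReturn i j {u} {v} u∈ v∈ =
      trans (cong₂ (λ p s → when (a ≡ᵇ p) (when (b ≡ᵇ s) (- sign (i ℕ.+ j))))
                   (Peak-firstReturn u v (proj₁ (∈-Dyck i u∈))) (sDegree-firstReturn {i} {j} u∈ v∈))
            (cong (λ c → pairTerm (nilIndicator u) (- c) i j u v) (sign-+ i j))

  quadratic-dyckSeries : ∀ m → (rsSubst dyckSeries ⊛ dyckSeries) (suc m) a b ≡
    ∑[ i + j ≡ m ] ∑[ u ← Dyck i ] ∑[ v ← Dyck j ] pairTerm 0 (sign i * sign j) i j u v
  quadratic-dyckSeries m =
    trans (rsSubst⊛-suc dyckSeries dyckSeries m a b) (∑-antidiag-cong m λ i i' →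
      trans (∑-antidiag-cong a λ j j' → ∑-antidiag-cong b λ k k' →
               cong₂ _*_ (rsSubst-dyckSeries i j k) (dyckSeries-gf i' j' k'))
            (gfCoeff-product (Dyck i) (Dyck i') Peak (λ u → suc (i ℕ.+ sDegree i u)) Peak (sDegree i') (sign i) (sign i') a b))

  pairSum : ℕ → ℕ → ℤ
  pairSum i j = ∑[ u ← Dyck i ] ∑[ v ← Dyck j ]
    (pairTerm (nilIndicator u) (- (sign i * sign j)) i j u v + pairTerm 0 (sign i * sign j) i j u v)

  -- For u ≠ [] the term of U u D v cancels the quadratic term of (u, v).
  pairSum-suc : ∀ i j → pairSum (suc i) j ≡ 0ℤ
  pairSum-suc i j = ∑-vanishes (Dyck (suc i)) λ u u∈ → ∑-vanishes (Dyck j) λ v _ →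
    trans (cong (λ p → pairTerm p (- c) (suc i) j u v + pairTerm 0 c (suc i) j u v) (nilIndicator-Dyck-suc i u∈))
          (when²-inverse (a ≡ᵇ Peak u ℕ.+ Peak v) (b ≡ᵇ suc (suc i ℕ.+ sDegree (suc i) u) ℕ.+ sDegree j v) c)
    where
    c = sign (suc i) * sign j

  pairSum-zero : ∀ m → pairSum 0 m ≡ - msDyck m a b + sDyck m a b
  pairSum-zero m =
    trans (ℤP.+-identityʳ _)
          (trans (∑-cong (Dyck m) λ v →
                    cong₂ _+_ (lowered v)
                              (cong (when (a ≡ᵇ Peak v) ∘ when (b ≡ᵇ suc (sDegree m v))) (ℤP.*-identityˡ (sign m))))
                 (trans (∑-+ (Dyck m) _ _) (cong (_+ sDyck m a b) (∑-neg (Dyck m) _))))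
    where
    lowered : ∀ v → when (a ≡ᵇ suc (Peak v)) (when (b ≡ᵇ suc (sDegree m v)) (- (1ℤ * sign m)))
                      ≡ - when (a ≡ᵇ suc (Peak v)) (when (b ≡ᵇ suc (sDegree m v)) (sign m))
    lowered v = begin
        when (a ≡ᵇ suc (Peak v)) (when (b ≡ᵇ suc (sDegree m v)) (- (1ℤ * sign m)))
      ≡⟨ cong (λ c → when (a ≡ᵇ suc (Peak v)) (when (b ≡ᵇ suc (sDegree m v)) (- c))) (ℤP.*-identityˡ (sign m)) ⟩
        when (a ≡ᵇ suc (Peak v)) (when (b ≡ᵇ suc (sDegree m v)) (- sign m))
      ≡⟨ cong (when (a ≡ᵇ suc (Peak v))) (when-neg (b ≡ᵇ suc (sDegree m v)) (sign m)) ⟩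
        when (a ≡ᵇ suc (Peak v)) (- when (b ≡ᵇ suc (sDegree m v)) (sign m))
      ≡⟨ when-neg (a ≡ᵇ suc (Peak v)) _ ⟩
        - when (a ≡ᵇ suc (Peak v)) (when (b ≡ᵇ suc (sDegree m v)) (sign m))
      ∎

  dyckSeries+quadratic : ∀ m → dyckSeries (suc m) a b + (rsSubst dyckSeries ⊛ dyckSeries) (suc m) a b ≡
    - msDyck m a b + sDyck m a b
  dyckSeries+quadratic m = begin
      dyckSeries (suc m) a b + (rsSubst dyckSeries ⊛ dyckSeries) (suc m) a b
    ≡⟨ cong₂ _+_ (dyckSeries-firstReturn m) (quadratic-dyckSeries m) ⟩
      ∑[ i + j ≡ m ] ∑[ u ← Dyck i ] ∑[ v ← Dyck j ] pairTerm (nilIndicator u) (- (sign i * sign j)) i j u v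
        + ∑[ i + j ≡ m ] ∑[ u ← Dyck i ] ∑[ v ← Dyck j ] pairTerm 0 (sign i * sign j) i j u v
    ≡⟨ sym (∑-antidiag-+ m _ _) ⟩
      ∑[ i + j ≡ m ] (∑[ u ← Dyck i ] ∑[ v ← Dyck j ] pairTerm (nilIndicator u) (- (sign i * sign j)) i j u v
                        + ∑[ u ← Dyck i ] ∑[ v ← Dyck j ] pairTerm 0 (sign i * sign j) i j u v)
    ≡⟨ (∑-antidiag-cong m λ i j → sym (trans (∑-cong (Dyck i) λ u → ∑-+ (Dyck j) _ _) (∑-+ (Dyck i) _ _))) ⟩
      ∑-antidiag m pairSum
    ≡⟨ ∑-antidiag-head m pairSum pairSum-suc ⟩
      pairSum 0 m
    ≡⟨ pairSum-zero m ⟩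
      - msDyck m a b + sDyck m a b
    ∎

dyckSeries-Recurrence : Recurrence dyckSeries
dyckSeries-Recurrence zero a b =
  trans (cong₂ _+_ (ℤP.+-identityʳ (oneS 0 a b)) (correction-zero dyckSeries a b))
        (cong (λ q → oneS 0 a b - q) (sym (rsSubst⊛-zero dyckSeries dyckSeries a b)))
dyckSeries-Recurrence (suc m) a b = begin
    χ + correction dyckSeries (suc m) a b
  ≡⟨ cong (χ +_) (correction-dyckSeries m a b) ⟩
    χ + (X - Y)
  ≡⟨ rearrange χ Q X Y ⟩
    (χ + Q) + (X - Y) - Q
  ≡⟨ cong (λ z → z + (X - Y) - Q) (dyckSeries+quadratic a b m) ⟩
    (- X + Y) + (X - Y) - Q
  ≡⟨ cancel X Y Q ⟩
    0ℤ - Q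
  ∎
  where
  χ = dyckSeries (suc m) a b
  Q = (rsSubst dyckSeries ⊛ dyckSeries) (suc m) a b
  X = msDyck m a b
  Y = sDyck m a b
  rearrange : ∀ χ Q X Y → χ + (X - Y) ≡ (χ + Q) + (X - Y) - Q
  rearrange = solve-∀
  cancel : ∀ X Y Q → (- X + Y) + (X - Y) - Q ≡ 0ℤ - Q
  cancel = solve-∀

-- Polynomiality

≡ᵇ-false : ∀ {x y} → y < x → (x ≡ᵇ y) ≡ false
≡ᵇ-false {suc x} {zero}  _          = refl
≡ᵇ-false {suc x} {suc y} (s≤s y<x) = ≡ᵇ-false y<x

dyckSeries-PolyCoeffs : PolyCoeffs dyckSeries
dyckSeries-PolyCoeffs n = degreeBound n , λ a b large →
  trans (dyckSeries-gf n a b) (∑-vanishes (Dyck n) (λ μ μ∈ → vanish a b μ∈ large))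
  where
  vanish : ∀ a b {μ} → μ ∈ Dyck n → degreeBound n ≤ a ⊎ degreeBound n ≤ b →
    when (a ≡ᵇ Peak μ) (when (b ≡ᵇ sDegree n μ) (sign n)) ≡ 0ℤ
  vanish a b {μ} μ∈ (inj₁ B≤a) =
    cong (λ t → when t (when (b ≡ᵇ sDegree n μ) (sign n))) (≡ᵇ-false (ℕP.<-≤-trans (Peak<degreeBound n μ∈) B≤a))
  vanish a b {μ} μ∈ (inj₂ B≤b) =
    trans (cong (λ t → when (a ≡ᵇ Peak μ) (when t (sign n)))
                (≡ᵇ-false (ℕP.<-≤-trans (sDegree<degreeBound n μ∈) B≤b)))
          (when-0 _)

mainTheorem15 : (PolyCoeffs dyckSeries × FunEq dyckSeries)
              × (∀ χ → PolyCoeffs χ → FunEq χ → χ ≈ dyckSeries)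
mainTheorem15 =
  (dyckSeries-PolyCoeffs , Recurrence⇒FunEq dyckSeries-Recurrence) ,
  λ χ _ funEq → Recurrence-unique (FunEq⇒Recurrence funEq) dyckSeries-Recurrence
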